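{- Every Chip Firing Game that reaches a fixed point is equivalent to a simple Chip Firing Game.
   Context: A Chip Firing Game (CFG) is given by a finite directed multigraph $G=(V,E)$ (the support graph; loops and multiple edges allowed) and an initial configuration $\sigma_0:V\to\mathbb{N}$, where $\sigma(v)$ is the number of chips on $v$. Firing rule: in a configuration $\sigma$, if a vertex $v$ holds at least $d^+(v)$ chips (its out-degree), one may fire $v$, sending one chip along each outgoing edge of $v$ to its head; write $\sigma\xrightarrow{v}\sigma'$. A CFG reaches a fixed point (is convergent) if from the initial configuration it cannot be played forever; it then reaches a unique final configuration where no firing is possible. An execution is a sequence of firings from the initial configuration to the final configuration. The configuration space of a convergent CFG is the set of configurations reachable from the initial one, ordered by $\sigma\le\sigma'$ iff $\sigma'$ is reachable from $\sigma$ by a (possibly empty) sequence of firings; it is a finite lattice. Two CFGs are equivalent if their configuration spaces are isomorphic as lattices. A CFG is simple if during an execution each vertex is fired at most once. -}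

module Defs where

open import Data.Nat using (ℕ; _≤_; _<_; _∸_; _+_)
open import Data.Fin using (Fin; _≟_)
open import Data.Vec using (Vec; lookup; tabulate; sum)
open import Data.List using (List; []; _∷_)
open import Data.List.Relation.Unary.Unique.Propositional using (Unique)
open import Data.Product using (Σ; _×_; _,_)
open import Relation.Binary.PropositionalEquality using (_≡_)
open import Relation.Binary.Construct.Closure.ReflexiveTransitive using (Star)
open import Relation.Nullary using (¬_; yes; no)
open import Function.Bundles using (_⇔_)

-- A finite directed multigraph on the vertex set Fin n (loops and multiple
-- edges allowed): G v w is the number of edges from v to w.
Graph : ℕ → Set
Graph n = Fin n → Fin n → ℕ

Config : ℕ → Set
Config n = Vec ℕ n

outdeg : ∀ {n} → Graph n → Fin n → ℕ
outdeg G v = sum (tabulate (G v))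

fire : ∀ {n} → Graph n → Fin n → Config n → Config n
fire G v σ = tabulate λ w → (lookup σ w ∸ lost w) + G v w
  where
  lost : _ → ℕ
  lost w with w ≟ v
  ... | yes _ = outdeg G v
  ... | no  _ = 0

Firable : ∀ {n} → Graph n → Config n → Fin n → Set
Firable G σ v = outdeg G v ≤ lookup σ v

data Step {n} (G : Graph n) : Config n → Config n → Set where
  step : ∀ {σ} v → Firable G σ v → Step G σ (fire G v σ)

-- reachability (reflexive-transitive closure); this is the order of the
-- configuration space: σ ≤ σ' iff Reach G σ σ'
Reach : ∀ {n} → Graph n → Config n → Config n → Set
Reach G = Star (Step G)

-- the CFG (G, σ₀) reaches a fixed point: it cannot be played forever,
-- i.e. there is no infinite sequence of firings starting from σ₀
Convergent : ∀ {n} → Graph n → Config n → Set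
Convergent G σ₀ =
  ¬ (Σ (ℕ → Config _) λ f → (f 0 ≡ σ₀) × (∀ i → Step G (f i) (f (ℕ.suc i))))

Stable : ∀ {n} → Graph n → Config n → Set
Stable G σ = ∀ v → lookup σ v < outdeg G v

data Exec {n} (G : Graph n) : Config n → List (Fin n) → Set where
  done : ∀ {σ} → Stable G σ → Exec G σ []
  fireE : ∀ {σ vs} v → Firable G σ v → Exec G (fire G v σ) vs → Exec G σ (v ∷ vs)

Simple : ∀ {n} → Graph n → Config n → Set
Simple G σ₀ = ∀ vs → Exec G σ₀ vs → Unique vs

-- Equivalence of convergent CFGs: their configuration spaces (reachable
-- configurations ordered by reachability) are isomorphic.  A lattice
-- isomorphism is the same as an order isomorphism, which we state as a pair
-- of mutually inverse maps on reachable configurations that preserve and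
-- reflect the order.
record Equivalent {n m} (G : Graph n) (σ₀ : Config n)
                        (H : Graph m) (τ₀ : Config m) : Set where
  field
    to      : Config n → Config m
    from    : Config m → Config n
    to-reach   : ∀ σ → Reach G σ₀ σ → Reach H τ₀ (to σ)
    from-reach : ∀ τ → Reach H τ₀ τ → Reach G σ₀ (from τ)
    from-to : ∀ σ → Reach G σ₀ σ → from (to σ) ≡ σ
    to-from : ∀ τ → Reach H τ₀ τ → to (from τ) ≡ τ
    order   : ∀ σ σ' → Reach G σ₀ σ → Reach G σ₀ σ' →
              (Reach G σ σ' ⇔ Reach H (to σ) (to σ'))

{-# OPTIONS --safe #-}
-- A shot vector x (how often each vertex has fired) determines the configuration it leads to, and in a
-- convergent game distinct reachable shot vectors lead to distinct configurations: two of them with the same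
-- configuration can be joined, and replaying the join from the other one produces such a pair again, strictly
-- later in a play, which would make the play infinite. Configurations have entries bounded by the number of
-- chips, so by the pigeonhole principle every execution is shorter than some K and every vertex fires fewer
-- than K times.
--
-- The simple game splits each vertex v into copies (v, 0), ..., (v, K - 1), copy i performing the i-th firing
-- of v: it sends G v w chips to every copy of w, W chips to copy i + 1, and pads its out-degree to a common
-- value Out with edges to a sink that can never fire. W exceeds every amount of chips a vertex of G receives,
-- so copy i + 1 cannot fire before copy i, and the initial configuration is calibrated so that copy x v of v
-- can fire exactly when v can fire after the firings x. Hence the shot vectors of the simple game are the 0/1
-- encodings of those of G, firing sequences correspond, and both configuration spaces are ordered copies of
-- the set of reachable shot vectors of G.

module Submission where

open import Defs
open import Data.Nat using (ℕ)
open import Data.Product using (Σ; _×_)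

open import Data.Nat.Base using (zero; suc; _+_; _*_; _∸_; _^_; _⊔_; _≤_; _<_; z≤n; s≤s)
open import Data.Nat.Properties
open import Data.Nat.DivMod using (_mod_; m≤n⇒m%n≡m)
open import Data.Nat.Tactic.RingSolver using (solve-∀)
open import Algebra.Properties.CommutativeSemigroup +-commutativeSemigroup using (interchange; xy∙z≈xz∙y)
open import Algebra.Properties.CommutativeMonoid.Sum +-0-commutativeMonoid
  using (sum; sum-cong-≗; ∑-distrib-+; sum-replicate-zero)
open import Data.Fin.Base as Fin using (Fin; toℕ; fromℕ<; combine; remQuot; funToFin; finToFun)
import Data.Fin.Properties as Finₚ
open import Data.Vec.Base as Vec using (Vec; lookup; tabulate; zipWith)
open import Data.Vec.Properties using (lookup∘tabulate; tabulate∘lookup; tabulate-cong; lookup-zipWith; zipWith-comm)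
import Data.Vec.Properties as Vecₚ
open import Data.Vec.Functional using (Vector)
open import Data.List.Base using (List; []; _∷_; length; _++_)
open import Data.List.Membership.Propositional using (_∈_)
open import Data.List.Relation.Unary.Any using (here; there)
import Data.List.Relation.Unary.All as All
open import Data.List.Relation.Unary.AllPairs using ([]; _∷_)
open import Data.List.Relation.Unary.Unique.Propositional using (Unique)
open import Data.Product using (_,_; proj₁; proj₂; ∃; ∃-syntax)
open import Data.Empty using (⊥; ⊥-elim)
open import Function.Base using (_∘_; flip)
open import Function.Bundles using (_⇔_; mk⇔; Equivalence)
open import Relation.Nullary using (¬_; Dec; yes; no)
open import Relation.Nullary.Decidable using (map′)
open import Relation.Binary.Definitions using (DecidableEquality; tri<; tri≈; tri>)
open import Relation.Binary.PropositionalEquality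
open import Relation.Binary.Construct.Closure.ReflexiveTransitive using (Star; ε; _◅_)

sum-tabulate : ∀ {n} (f : Vector ℕ n) → Vec.sum (tabulate f) ≡ sum f
sum-tabulate {zero}  f = refl
sum-tabulate {suc n} f = cong (f Fin.zero +_) (sum-tabulate (λ i → f (Fin.suc i)))

sum-zero : ∀ {n} {f : Vector ℕ n} → (∀ i → f i ≡ 0) → sum f ≡ 0
sum-zero {n} f≗0 = trans (sum-cong-≗ f≗0) (sum-replicate-zero n)

sum-mono-≤ : ∀ {n} {f g : Vector ℕ n} → (∀ i → f i ≤ g i) → sum f ≤ sum g
sum-mono-≤ {zero}  f≤g = z≤n
sum-mono-≤ {suc n} f≤g = +-mono-≤ (f≤g Fin.zero) (sum-mono-≤ (λ i → f≤g (Fin.suc i)))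

≤-sum : ∀ {n} (f : Vector ℕ n) (i : Fin n) → f i ≤ sum f
≤-sum f Fin.zero    = m≤m+n _ _
≤-sum f (Fin.suc i) = ≤-trans (≤-sum (λ j → f (Fin.suc j)) i) (m≤n+m _ (f Fin.zero))

sum-single : ∀ {n} (f : Vector ℕ n) (j : Fin n) → (∀ i → i ≢ j → f i ≡ 0) → sum f ≡ f j
sum-single f Fin.zero f≡0 =
  trans (cong (f Fin.zero +_) (sum-zero (λ i → f≡0 (Fin.suc i) (λ ())))) (+-identityʳ _)
sum-single f (Fin.suc j) f≡0 rewrite f≡0 Fin.zero (λ ()) =
  sum-single (λ i → f (Fin.suc i)) j (λ i i≢j → f≡0 (Fin.suc i) (i≢j ∘ Finₚ.suc-injective))

⟦_⟧ : {A : Set} → Dec A → ℕ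
⟦ yes _ ⟧ = 1
⟦ no  _ ⟧ = 0

⟦⟧-yes : {A : Set} (a? : Dec A) → A → ⟦ a? ⟧ ≡ 1
⟦⟧-yes (yes _) _ = refl
⟦⟧-yes (no ¬a) a = ⊥-elim (¬a a)

⟦⟧-no : {A : Set} (a? : Dec A) → ¬ A → ⟦ a? ⟧ ≡ 0
⟦⟧-no (yes a) ¬a = ⊥-elim (¬a a)
⟦⟧-no (no _)  _  = refl

⟦⟧≤1 : {A : Set} (a? : Dec A) → ⟦ a? ⟧ ≤ 1
⟦⟧≤1 (yes _) = s≤s z≤n
⟦⟧≤1 (no _)  = z≤n

⟦⟧-cong : {A B : Set} (a? : Dec A) (b? : Dec B) → (A → B) → (B → A) → ⟦ a? ⟧ ≡ ⟦ b? ⟧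
⟦⟧-cong (yes a) b? A→B B→A = sym (⟦⟧-yes b? (A→B a))
⟦⟧-cong (no ¬a) b? A→B B→A = sym (⟦⟧-no b? (¬a ∘ B→A))

δ : ∀ {n} → Fin n → Fin n → ℕ
δ v w = ⟦ w Finₚ.≟ v ⟧

δ-same : ∀ {n} (v : Fin n) → δ v v ≡ 1
δ-same v = ⟦⟧-yes (v Finₚ.≟ v) refl

δ-other : ∀ {n} {v w : Fin n} → w ≢ v → δ v w ≡ 0
δ-other {v = v} {w} = ⟦⟧-no (w Finₚ.≟ v)

sum-δ : ∀ {n} (v : Fin n) → sum (δ v) ≡ 1
sum-δ v = trans (sum-single (δ v) v (λ _ → δ-other)) (δ-same v)

sum-*δ : ∀ {n} (f : Fin n → ℕ) (v : Fin n) → sum (λ u → f u * δ v u) ≡ f v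
sum-*δ f v = begin
  sum (λ u → f u * δ v u) ≡⟨ sum-single _ v (λ u u≢v → trans (cong (f u *_) (δ-other u≢v)) (*-zeroʳ (f u))) ⟩
  f v * δ v v             ≡⟨ cong (f v *_) (δ-same v) ⟩
  f v * 1                 ≡⟨ *-identityʳ (f v) ⟩
  f v                     ∎
  where open ≡-Reasoning

lookup-ext : ∀ {n} {xs ys : Vec ℕ n} → (∀ i → lookup xs i ≡ lookup ys i) → xs ≡ ys
lookup-ext {xs = xs} {ys} xs≗ys =
  trans (sym (tabulate∘lookup xs)) (trans (tabulate-cong xs≗ys) (tabulate∘lookup ys))

_≟ᵥ_ : ∀ {n} → DecidableEquality (Vec ℕ n)
_≟ᵥ_ = Vecₚ.≡-dec _≟_

lookup-tabulate-≡ : ∀ {n} {xs : Vec ℕ n} {f : Fin n → ℕ} → xs ≡ tabulate f → ∀ i → lookup xs i ≡ f i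
lookup-tabulate-≡ refl = lookup∘tabulate _

module _ {n} (G : Graph n) {v : Fin n} (σ : Config n) where

  lookup-fire-same : lookup (fire G v σ) v ≡ (lookup σ v ∸ outdeg G v) + G v v
  lookup-fire-same with v Finₚ.≟ v | lookup-tabulate-≡ {xs = fire G v σ} refl v
  ... | yes _  | eq = eq
  ... | no v≢v | _  = ⊥-elim (v≢v refl)

  lookup-fire-other : ∀ {w} → w ≢ v → lookup (fire G v σ) w ≡ lookup σ w + G v w
  lookup-fire-other {w} w≢v with w Finₚ.≟ v | lookup-tabulate-≡ {xs = fire G v σ} refl w
  ... | yes w≡v | _  = ⊥-elim (w≢v w≡v)
  ... | no _    | eq = eq

outdeg-sum : ∀ {n} (G : Graph n) v → outdeg G v ≡ sum (G v)
outdeg-sum G v = sum-tabulate (G v)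

module _ {A : Set} (R : A → A → Set) where

  Infinite : A → Set
  Infinite a = Σ (ℕ → A) λ f → (f 0 ≡ a) × (∀ i → R (f i) (f (suc i)))

  recurrent⇒infinite : (P : A → Set) → (∀ {a} → P a → ∃[ b ] P b × ∃[ c ] R a c × Star R c b) →
                       ∀ {a b} → Star R a b → P b → Infinite a
  recurrent⇒infinite P progress {a₀} {b₀} a₀→b₀ Pb₀ = proj₁ ∘ states , refl , proj₂ ∘ next ∘ states
    where
    State : Set
    State = Σ A λ a → ∃[ b ] Star R a b × P b

    next : (s : State) → Σ State λ s′ → R (proj₁ s) (proj₁ s′)
    next (a , b , r ◅ rs , Pb) = (_ , b , rs , Pb) , r
    next (a , a , ε , Pa) with b , Pb , c , r , rs ← progress Pa = (c , b , rs , Pb) , r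

    states : ℕ → State
    states zero    = a₀ , b₀ , a₀→b₀ , Pb₀
    states (suc i) = proj₁ (next (states i))

module _ {A B : Set} (R : A → A → Set) (S : B → B → Set) (_≈_ : A → B → Set)
         (simulate : ∀ {a b b′} → a ≈ b → S b b′ → ∃[ a′ ] R a a′ × a′ ≈ b′) where

  infinite-simulation : ∀ {a b} → a ≈ b → Infinite S b → Infinite R a
  infinite-simulation {a} a≈b (f , f0≡b , steps) = proj₁ ∘ track , refl , λ i → proj₁ (proj₂ (next i))
    where
    track : ∀ i → ∃[ a ] a ≈ f i
    next : ∀ i → ∃[ a′ ] R (proj₁ (track i)) a′ × a′ ≈ f (suc i)
    track zero    = a , subst (a ≈_) (sym f0≡b) a≈b
    track (suc i) = proj₁ (next i) , proj₂ (proj₂ (next i))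
    next i = simulate (proj₂ (track i)) (steps i)

module _ {n} (G : Graph n) where

  chips : Config n → ℕ
  chips σ = sum (lookup σ)

  fire-balance : ∀ {σ v} → Firable G σ v → ∀ w → lookup (fire G v σ) w + outdeg G v * δ v w ≡ lookup σ w + G v w
  fire-balance {σ} {v} firable w = by-cases (w Finₚ.≟ v)
    where
    open ≡-Reasoning
    by-cases : Dec (w ≡ v) → lookup (fire G v σ) w + outdeg G v * δ v w ≡ lookup σ w + G v w
    by-cases (yes refl) = begin
      lookup (fire G w σ) w + outdeg G w * δ w w
        ≡⟨ cong₂ _+_ (lookup-fire-same G σ) (trans (cong (outdeg G w *_) (δ-same w)) (*-identityʳ (outdeg G w))) ⟩
      (lookup σ w ∸ outdeg G w) + G w w + outdeg G w
        ≡⟨ xy∙z≈xz∙y (lookup σ w ∸ outdeg G w) (G w w) (outdeg G w) ⟩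
      (lookup σ w ∸ outdeg G w) + outdeg G w + G w w
        ≡⟨ cong (_+ G w w) (m∸n+n≡m firable) ⟩
      lookup σ w + G w w ∎
    by-cases (no w≢v) = begin
      lookup (fire G v σ) w + outdeg G v * δ v w
        ≡⟨ cong₂ _+_ (lookup-fire-other G σ w≢v) (trans (cong (outdeg G v *_) (δ-other w≢v)) (*-zeroʳ (outdeg G v))) ⟩
      lookup σ w + G v w + 0
        ≡⟨ +-identityʳ _ ⟩
      lookup σ w + G v w ∎

  fire-chips : ∀ {σ v} → Firable G σ v → chips (fire G v σ) ≡ chips σ
  fire-chips {σ} {v} firable = +-cancelʳ-≡ (outdeg G v) _ _ (begin
    chips (fire G v σ) + outdeg G v
      ≡⟨ cong (chips (fire G v σ) +_) (sum-*δ (λ _ → outdeg G v) v) ⟨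
    chips (fire G v σ) + sum (λ w → outdeg G v * δ v w)
      ≡⟨ ∑-distrib-+ (lookup (fire G v σ)) (λ w → outdeg G v * δ v w) ⟨
    sum (λ w → lookup (fire G v σ) w + outdeg G v * δ v w)
      ≡⟨ sum-cong-≗ (fire-balance {σ} firable) ⟩
    sum (λ w → lookup σ w + G v w)
      ≡⟨ ∑-distrib-+ (lookup σ) (G v) ⟩
    chips σ + sum (G v)
      ≡⟨ cong (chips σ +_) (outdeg-sum G v) ⟨
    chips σ + outdeg G v ∎)
    where open ≡-Reasoning

  reach-chips : ∀ {σ σ′} → Reach G σ σ′ → chips σ′ ≡ chips σ
  reach-chips ε                            = refl
  reach-chips {σ} (step v firable ◅ steps) = trans (reach-chips steps) (fire-chips {σ} firable)

  reach-bounded : ∀ {σ σ′} → Reach G σ σ′ → ∀ w → lookup σ′ w ≤ chips σ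
  reach-bounded {σ′ = σ′} steps w = subst (lookup σ′ w ≤_) (reach-chips steps) (≤-sum (lookup σ′) w)

code : ∀ {n} T → Vec ℕ n → Fin (suc T ^ n)
code T xs = funToFin (λ w → lookup xs w mod suc T)

code-injective : ∀ {n} T {xs ys : Vec ℕ n} → (∀ w → lookup xs w ≤ T) → (∀ w → lookup ys w ≤ T) →
                 code T xs ≡ code T ys → xs ≡ ys
code-injective T {xs} {ys} xs≤T ys≤T codes≡ = lookup-ext λ w → begin
  lookup xs w                        ≡⟨ digit (xs≤T w) ⟨
  toℕ (lookup xs w mod suc T)        ≡⟨ cong toℕ (trans (sym (Finₚ.finToFun-funToFin _ w))
                                                       (trans (cong (λ c → finToFun c w) codes≡) (Finₚ.finToFun-funToFin _ w))) ⟩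
  toℕ (lookup ys w mod suc T)        ≡⟨ digit (ys≤T w) ⟩
  lookup ys w                        ∎
  where
  open ≡-Reasoning
  digit : ∀ {a} → a ≤ T → toℕ (a mod suc T) ≡ a
  digit a≤T = trans (Finₚ.toℕ-fromℕ< _) (m≤n⇒m%n≡m a≤T)

∃-list≤? : ∀ {n} k (Q : List (Fin n) → Set) → (∀ vs → Dec (Q vs)) → Dec (∃[ vs ] length vs ≤ k × Q vs)
∃-list≤? zero Q Q? with Q? []
... | yes q = yes ([] , z≤n , q)
... | no ¬q = no λ { ([] , _ , q) → ¬q q }
∃-list≤? (suc k) Q Q? with Q? [] | Finₚ.any? (λ v → ∃-list≤? k (Q ∘ (v ∷_)) (Q? ∘ (v ∷_)))
... | yes q  | _                             = yes ([] , z≤n , q)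
... | no _   | yes (v , vs , len≤k , q)      = yes (v ∷ vs , s≤s len≤k , q)
... | no ¬q  | no ¬cons                      = no λ { ([] , _ , q) → ¬q q
                                                   ; (v ∷ vs , s≤s len≤k , q) → ¬cons (v , vs , len≤k , q) }

module ShotVectors {n} (G : Graph n) (σ₀ : Config n) where

  Shot : Set
  Shot = Vec ℕ n

  d : Fin n → ℕ
  d = outdeg G

  gain : Shot → Fin n → ℕ
  gain x w = sum (λ u → G u w * lookup x u)

  -- Truncated subtraction: cfg x is the configuration reached by the firings x only when x is Valid.
  cfg : Shot → Config n
  cfg x = tabulate (λ w → (lookup σ₀ w + gain x w) ∸ d w * lookup x w)

  record CanFire (x : Shot) (v : Fin n) : Set where
    constructor canFire
    field affordable : d v * suc (lookup x v) ≤ lookup σ₀ v + gain x v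

  record Valid (x : Shot) : Set where
    constructor valid
    field spent≤received : ∀ w → d w * lookup x w ≤ lookup σ₀ w + gain x w

  open CanFire public
  open Valid public

  _≤ₛ_ : Shot → Shot → Set
  x ≤ₛ y = ∀ w → lookup x w ≤ lookup y w

  zeros : Shot
  zeros = Vec.replicate n 0

  inc : Shot → Fin n → Shot
  inc x v = tabulate (λ w → lookup x w + δ v w)

  lookup-zeros : ∀ w → lookup zeros w ≡ 0
  lookup-zeros w = Vecₚ.lookup-replicate w 0

  lookup-inc : ∀ x v w → lookup (inc x v) w ≡ lookup x w + δ v w
  lookup-inc x v = lookup∘tabulate _

  lookup-inc-same : ∀ x v → lookup (inc x v) v ≡ suc (lookup x v)
  lookup-inc-same x v = begin
    lookup (inc x v) v  ≡⟨ lookup-inc x v v ⟩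
    lookup x v + δ v v  ≡⟨ cong (lookup x v +_) (δ-same v) ⟩
    lookup x v + 1      ≡⟨ +-comm (lookup x v) 1 ⟩
    suc (lookup x v)    ∎
    where open ≡-Reasoning

  lookup-inc-other : ∀ x {v w} → w ≢ v → lookup (inc x v) w ≡ lookup x w
  lookup-inc-other x {v} {w} w≢v =
    trans (lookup-inc x v w) (trans (cong (lookup x w +_) (δ-other w≢v)) (+-identityʳ _))

  ≤ₛ-inc : ∀ x v → x ≤ₛ inc x v
  ≤ₛ-inc x v w = subst (lookup x w ≤_) (sym (lookup-inc x v w)) (m≤m+n _ _)

  gain-zeros : ∀ w → gain zeros w ≡ 0
  gain-zeros w = sum-zero (λ u → trans (cong (G u w *_) (lookup-zeros u)) (*-zeroʳ (G u w)))

  gain-inc : ∀ x v w → gain (inc x v) w ≡ gain x w + G v w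
  gain-inc x v w = begin
    sum (λ u → G u w * lookup (inc x v) u)
      ≡⟨ sum-cong-≗ (λ u → trans (cong (G u w *_) (lookup-inc x v u)) (*-distribˡ-+ (G u w) _ _)) ⟩
    sum (λ u → G u w * lookup x u + G u w * δ v u)
      ≡⟨ ∑-distrib-+ (λ u → G u w * lookup x u) (λ u → G u w * δ v u) ⟩
    gain x w + sum (λ u → G u w * δ v u)
      ≡⟨ cong (gain x w +_) (sum-*δ (λ u → G u w) v) ⟩
    gain x w + G v w ∎
    where open ≡-Reasoning

  gain-mono : ∀ {x y} → x ≤ₛ y → ∀ w → gain x w ≤ gain y w
  gain-mono x≤y w = sum-mono-≤ (λ u → *-monoʳ-≤ (G u w) (x≤y u))

  balance⇒cfg : ∀ {σ x} → (∀ w → lookup σ w + d w * lookup x w ≡ lookup σ₀ w + gain x w) → σ ≡ cfg x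
  balance⇒cfg {σ} {x} balance = lookup-ext λ w → begin
    lookup σ w                                             ≡⟨ m+n∸n≡m (lookup σ w) (d w * lookup x w) ⟨
    (lookup σ w + d w * lookup x w) ∸ d w * lookup x w    ≡⟨ cong (_∸ d w * lookup x w) (balance w) ⟩
    (lookup σ₀ w + gain x w) ∸ d w * lookup x w           ≡⟨ lookup∘tabulate _ w ⟨
    lookup (cfg x) w                                       ∎
    where open ≡-Reasoning

  cfg-balance : ∀ {x} → Valid x → ∀ w → lookup (cfg x) w + d w * lookup x w ≡ lookup σ₀ w + gain x w
  cfg-balance x-valid w = trans (cong (_+ _) (lookup∘tabulate _ w)) (m∸n+n≡m (spent≤received x-valid w))

  cfg-zeros : cfg zeros ≡ σ₀
  cfg-zeros = sym (balance⇒cfg {x = zeros} λ w →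
    cong (lookup σ₀ w +_) (trans (cong (d w *_) (lookup-zeros w)) (trans (*-zeroʳ (d w)) (sym (gain-zeros w)))))

  zeros-valid : Valid zeros
  zeros-valid = valid λ w →
    subst (_≤ lookup σ₀ w + gain zeros w) (sym (trans (cong (d w *_) (lookup-zeros w)) (*-zeroʳ (d w)))) z≤n

  inc-valid : ∀ {x v} → Valid x → CanFire x v → Valid (inc x v)
  inc-valid {x} {v} (valid x-valid) (canFire v-affordable) = valid pointwise
    where
    pointwise : ∀ w → d w * lookup (inc x v) w ≤ lookup σ₀ w + gain (inc x v) w
    pointwise w with w Finₚ.≟ v
    ... | yes refl rewrite lookup-inc-same x w | gain-inc x w w = ≤-trans v-affordable (+-monoʳ-≤ (lookup σ₀ w) (m≤m+n _ _))
    ... | no w≢v rewrite lookup-inc-other x w≢v | gain-inc x v w = ≤-trans (x-valid w) (+-monoʳ-≤ (lookup σ₀ w) (m≤m+n _ _))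

  module _ {x : Shot} {v : Fin n} (x-valid : Valid x) where

    private
      dx : ℕ
      dx = d v * lookup x v

    canFire⇒firable : CanFire x v → Firable G (cfg x) v
    canFire⇒firable (canFire v-affordable) =
      +-cancelʳ-≤ dx _ _ (subst₂ _≤_ (*-suc (d v) (lookup x v)) (sym (cfg-balance x-valid v)) v-affordable)

    firable⇒canFire : Firable G (cfg x) v → CanFire x v
    firable⇒canFire firable =
      canFire (subst₂ _≤_ (sym (*-suc (d v) (lookup x v))) (cfg-balance x-valid v) (+-monoˡ-≤ dx firable))

  private
    +-shuffle : ∀ a g e x → (a + g) + e * suc x ≡ (a + e) + e * x + g
    +-shuffle = solve-∀

  fire-cfg : ∀ {x v} → Valid x → CanFire x v → fire G v (cfg x) ≡ cfg (inc x v)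
  fire-cfg {x} {v} x-valid v-fires = balance⇒cfg {x = inc x v} balance
    where
    open ≡-Reasoning
    c : Fin n → ℕ
    c = lookup (cfg x)
    balance : ∀ w → lookup (fire G v (cfg x)) w + d w * lookup (inc x v) w ≡ lookup σ₀ w + gain (inc x v) w
    balance w with w Finₚ.≟ v
    ... | yes refl = begin
      lookup (fire G w (cfg x)) w + d w * lookup (inc x w) w
        ≡⟨ cong₂ _+_ (lookup-fire-same G (cfg x)) (cong (d w *_) (lookup-inc-same x w)) ⟩
      ((c w ∸ d w) + G w w) + d w * suc (lookup x w)
        ≡⟨ +-shuffle (c w ∸ d w) (G w w) (d w) (lookup x w) ⟩
      ((c w ∸ d w) + d w) + d w * lookup x w + G w w
        ≡⟨ cong (λ a → a + d w * lookup x w + G w w) (m∸n+n≡m (canFire⇒firable x-valid v-fires)) ⟩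
      c w + d w * lookup x w + G w w
        ≡⟨ cong (_+ G w w) (cfg-balance x-valid w) ⟩
      lookup σ₀ w + gain x w + G w w
        ≡⟨ +-assoc (lookup σ₀ w) _ _ ⟩
      lookup σ₀ w + (gain x w + G w w)
        ≡⟨ cong (lookup σ₀ w +_) (gain-inc x w w) ⟨
      lookup σ₀ w + gain (inc x w) w ∎
    ... | no w≢v = begin
      lookup (fire G v (cfg x)) w + d w * lookup (inc x v) w
        ≡⟨ cong₂ _+_ (lookup-fire-other G (cfg x) w≢v) (cong (d w *_) (lookup-inc-other x w≢v)) ⟩
      (c w + G v w) + d w * lookup x w
        ≡⟨ xy∙z≈xz∙y (c w) (G v w) (d w * lookup x w) ⟩
      c w + d w * lookup x w + G v w
        ≡⟨ cong (_+ G v w) (cfg-balance x-valid w) ⟩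
      lookup σ₀ w + gain x w + G v w
        ≡⟨ +-assoc (lookup σ₀ w) _ _ ⟩
      lookup σ₀ w + (gain x w + G v w)
        ≡⟨ cong (lookup σ₀ w +_) (gain-inc x v w) ⟨
      lookup σ₀ w + gain (inc x v) w ∎

  infixr 5 _∷_
  data Path : Shot → List (Fin n) → Shot → Set where
    []  : ∀ {x} → Path x [] x
    _∷_ : ∀ {x v vs y} → CanFire x v → Path (inc x v) vs y → Path x (v ∷ vs) y

  path-valid : ∀ {x vs y} → Valid x → Path x vs y → Valid y
  path-valid x-valid []               = x-valid
  path-valid x-valid (v-fires ∷ path) = path-valid (inc-valid x-valid v-fires) path

  fire-step : ∀ {x v} → Valid x → CanFire x v → Step G (cfg x) (cfg (inc x v))
  fire-step {x} {v} x-valid v-fires =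
    subst (Step G (cfg x)) (fire-cfg x-valid v-fires) (step v (canFire⇒firable x-valid v-fires))

  path⇒reach : ∀ {x vs y} → Valid x → Path x vs y → Reach G (cfg x) (cfg y)
  path⇒reach x-valid []               = ε
  path⇒reach x-valid (v-fires ∷ path) = fire-step x-valid v-fires ◅ path⇒reach (inc-valid x-valid v-fires) path

  reach⇒path : ∀ {x σ} → Valid x → Reach G (cfg x) σ → ∃[ vs ] ∃[ y ] Path x vs y × cfg y ≡ σ
  reach⇒path x-valid = go x-valid refl
    where
    go : ∀ {x σ σ′} → Valid x → σ ≡ cfg x → Reach G σ σ′ → ∃[ vs ] ∃[ y ] Path x vs y × cfg y ≡ σ′
    go {x} x-valid refl ε = [] , x , [] , refl
    go {x} x-valid refl (step v firable ◅ steps)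
      with v-fires ← firable⇒canFire x-valid firable
      with vs , y , path , refl ← go (inc-valid x-valid v-fires) (fire-cfg x-valid v-fires) steps
      = v ∷ vs , y , v-fires ∷ path , refl

  exec⇒path : ∀ {x vs} → Valid x → Exec G (cfg x) vs → ∃ (Path x vs)
  exec⇒path x-valid = go x-valid refl
    where
    go : ∀ {x σ vs} → Valid x → σ ≡ cfg x → Exec G σ vs → ∃ (Path x vs)
    go {x} x-valid refl (done _) = x , []
    go {x} x-valid refl (fireE v firable exec)
      with v-fires ← firable⇒canFire x-valid firable
      with y , path ← go (inc-valid x-valid v-fires) (fire-cfg x-valid v-fires) exec
      = y , v-fires ∷ path

  path-≤ₛ : ∀ {x vs y} → Path x vs y → x ≤ₛ y
  path-≤ₛ []                              w = ≤-refl
  path-≤ₛ {x} (_∷_ {v = v} v-fires path) w = ≤-trans (≤ₛ-inc x v w) (path-≤ₛ path w)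

  path-deterministic : ∀ {x vs y y′} → Path x vs y → Path x vs y′ → y ≡ y′
  path-deterministic []         []          = refl
  path-deterministic (_ ∷ path) (_ ∷ path′) = path-deterministic path path′

  path-++ : ∀ {x vs y ws z} → Path x vs y → Path y ws z → Path x (vs ++ ws) z
  path-++ []               path′ = path′
  path-++ (v-fires ∷ path) path′ = v-fires ∷ path-++ path path′

  canFire? : ∀ x v → Dec (CanFire x v)
  canFire? x v = map′ canFire affordable (_ ≤? _)

  path? : ∀ x vs → Dec (∃ (Path x vs))
  path? x []       = yes (x , [])
  path? x (v ∷ vs) with canFire? x v | path? (inc x v) vs
  ... | yes v-fires | yes (y , path) = yes (y , v-fires ∷ path)
  ... | yes _       | no ¬path       = no λ { (y , _ ∷ path) → ¬path (y , path) }
  ... | no ¬v-fires | _              = no λ { (_ , v-fires ∷ _) → ¬v-fires v-fires }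

  ∣_∣ : Shot → ℕ
  ∣ x ∣ = sum (lookup x)

  ∣inc∣ : ∀ x v → ∣ inc x v ∣ ≡ suc ∣ x ∣
  ∣inc∣ x v = begin
    sum (lookup (inc x v))           ≡⟨ sum-cong-≗ (lookup-inc x v) ⟩
    sum (λ w → lookup x w + δ v w)   ≡⟨ ∑-distrib-+ (lookup x) (δ v) ⟩
    ∣ x ∣ + sum (δ v)                ≡⟨ cong (∣ x ∣ +_) (sum-δ v) ⟩
    ∣ x ∣ + 1                        ≡⟨ +-comm ∣ x ∣ 1 ⟩
    suc ∣ x ∣                        ∎
    where open ≡-Reasoning

  ∣zeros∣ : ∣ zeros ∣ ≡ 0
  ∣zeros∣ = sum-zero lookup-zeros

  path-length : ∀ {x vs y} → Path x vs y → ∣ y ∣ ≡ ∣ x ∣ + length vs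
  path-length []                            = sym (+-identityʳ _)
  path-length {x} (_∷_ {v = v} v-fires path) =
    trans (path-length path) (trans (cong (_+ _) (∣inc∣ x v)) (sym (+-suc ∣ x ∣ _)))

  ∈-path⇒< : ∀ {x vs y v} → v ∈ vs → Path x vs y → lookup x v < lookup y v
  ∈-path⇒< {x} (here refl) (_ ∷ path) =
    subst (_≤ _) (lookup-inc-same x _) (path-≤ₛ path _)
  ∈-path⇒< {x} {v = v} (there v∈vs) (_∷_ {v = u} _ path) =
    ≤-trans (s≤s (≤ₛ-inc x u v)) (∈-path⇒< v∈vs path)

  path-unique : ∀ {x vs y} → (∀ w → lookup y w ≤ 1) → Path x vs y → Unique vs
  path-unique y≤1 []                              = []
  path-unique {x} y≤1 (_∷_ {v = v} v-fires path) =
    All.tabulate (λ {u} u∈vs v≡u → fired-twice (subst (_∈ _) (sym v≡u) u∈vs)) ∷ path-unique y≤1 path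
    where
    fired-twice : v ∈ _ → ⊥
    fired-twice v∈vs = <⇒≱ (subst (_< _) (lookup-inc-same x v) (∈-path⇒< v∈vs path)) (≤-trans (y≤1 v) (s≤s z≤n))

  Reachable : Shot → Set
  Reachable x = ∃[ vs ] Path zeros vs x

  reachable-valid : ∀ {x} → Reachable x → Valid x
  reachable-valid (_ , path) = path-valid zeros-valid path

  reachable-path : ∀ {x vs y} → Reachable x → Path x vs y → Reachable y
  reachable-path (_ , path) path′ = _ , path-++ path path′

  reachable⇒reach : ∀ {x} → Reachable x → Reach G σ₀ (cfg x)
  reachable⇒reach {x} (_ , path) = subst (λ σ → Reach G σ (cfg x)) cfg-zeros (path⇒reach zeros-valid path)

  reach⇒reachable : ∀ {σ} → Reach G σ₀ σ → ∃[ x ] Reachable x × cfg x ≡ σ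
  reach⇒reachable steps with vs , x , path , refl ← reach⇒path zeros-valid (subst (λ σ → Reach G σ _) (sym cfg-zeros) steps) =
    x , (vs , path) , refl

  _⊔ₛ_ : Shot → Shot → Shot
  _⊔ₛ_ = zipWith _⊔_

  lookup-⊔ₛ : ∀ x y w → lookup (x ⊔ₛ y) w ≡ lookup x w ⊔ lookup y w
  lookup-⊔ₛ x y w = lookup-zipWith _⊔_ w x y

  ⊔ₛ-comm : ∀ x y → x ⊔ₛ y ≡ y ⊔ₛ x
  ⊔ₛ-comm = zipWith-comm ⊔-comm

  ⊔ₛ-absorbs : ∀ {x y} → y ≤ₛ x → x ⊔ₛ y ≡ x
  ⊔ₛ-absorbs {x} {y} y≤x = lookup-ext λ w → trans (lookup-⊔ₛ x y w) (m≥n⇒m⊔n≡m (y≤x w))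

  inc-⊔ₛ : ∀ {x y v} → lookup x v < lookup y v → inc x v ⊔ₛ y ≡ x ⊔ₛ y
  inc-⊔ₛ {x} {y} {v} x<y = lookup-ext pointwise
    where
    pointwise : ∀ w → lookup (inc x v ⊔ₛ y) w ≡ lookup (x ⊔ₛ y) w
    pointwise w with w Finₚ.≟ v
    ... | yes refl rewrite lookup-⊔ₛ (inc x w) y w | lookup-⊔ₛ x y w | lookup-inc-same x w =
      trans (m≤n⇒m⊔n≡n x<y) (sym (m≤n⇒m⊔n≡n (<⇒≤ x<y)))
    ... | no w≢v rewrite lookup-⊔ₛ (inc x v) y w | lookup-⊔ₛ x y w | lookup-inc-other x w≢v = refl

  inc-≤ₛ : ∀ {x y v} → x ≤ₛ y → lookup x v < lookup y v → inc x v ≤ₛ y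
  inc-≤ₛ {x} {y} {v} x≤y x<y w with w Finₚ.≟ v
  ... | yes refl = subst (_≤ lookup y w) (sym (lookup-inc-same x w)) x<y
  ... | no w≢v   = subst (_≤ lookup y w) (sym (lookup-inc-other x w≢v)) (x≤y w)

  inc-mono : ∀ {x y} v → x ≤ₛ y → inc x v ≤ₛ inc y v
  inc-mono {x} {y} v x≤y w = subst₂ _≤_ (sym (lookup-inc x v w)) (sym (lookup-inc y v w)) (+-monoˡ-≤ (δ v w) (x≤y w))

  canFire-mono : ∀ {x y v} → x ≤ₛ y → lookup x v ≡ lookup y v → CanFire x v → CanFire y v
  canFire-mono {x} {y} {v} x≤y x≡y (canFire v-affordable) = canFire (begin
    d v * suc (lookup y v)       ≡⟨ cong (λ t → d v * suc t) x≡y ⟨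
    d v * suc (lookup x v)       ≤⟨ v-affordable ⟩
    lookup σ₀ v + gain x v       ≤⟨ +-monoʳ-≤ (lookup σ₀ v) (gain-mono {x} {y} x≤y v) ⟩
    lookup σ₀ v + gain y v       ∎)
    where open ≤-Reasoning

  -- Firability only grows with the shot vector, so a play from z can be replayed from any c ≥ z,
  -- skipping the firings that c has already done.
  catch-up : ∀ {z vs b c} → Path z vs b → z ≤ₛ c → ∃[ cs ] Path c cs (c ⊔ₛ b)
  catch-up {z} {c = c} [] z≤c = [] , subst (Path c []) (sym (⊔ₛ-absorbs {c} {z} z≤c)) []
  catch-up {z} {b = b} {c} (_∷_ {v = v} v-fires path) z≤c with lookup z v <? lookup c v
  ... | yes z<c = catch-up path (inc-≤ₛ {z} {c} z≤c z<c)
  ... | no  z≮c with cs , path′ ← catch-up path (inc-mono {z} {c} v z≤c) =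
    v ∷ cs , canFire-mono {z} {c} z≤c z≡c v-fires ∷ subst (Path (inc c v) cs) (inc-⊔ₛ c<b) path′
    where
    z≡c : lookup z v ≡ lookup c v
    z≡c = ≤-antisym (z≤c v) (≮⇒≥ z≮c)
    c<b : lookup c v < lookup b v
    c<b = subst (_≤ lookup b v) (trans (lookup-inc-same z v) (cong suc z≡c)) (path-≤ₛ path v)

  join : ∀ {x as a bs b} → Path x as a → Path x bs b → ∃[ cs ] Path a cs (a ⊔ₛ b)
  join path-a path-b = catch-up path-b (path-≤ₛ path-a)

  module _ {a b} (a-valid : Valid a) (b-valid : Valid b) (a≈b : cfg a ≡ cfg b) where

    canFire-transport : ∀ {v} → CanFire a v → CanFire b v
    canFire-transport {v} v-fires =
      firable⇒canFire b-valid (subst (λ σ → Firable G σ v) a≈b (canFire⇒firable a-valid v-fires))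

    cfg-inc-transport : ∀ {v} (v-fires : CanFire a v) → cfg (inc a v) ≡ cfg (inc b v)
    cfg-inc-transport {v} v-fires = begin
      cfg (inc a v)      ≡⟨ fire-cfg a-valid v-fires ⟨
      fire G v (cfg a)   ≡⟨ cong (fire G v) a≈b ⟩
      fire G v (cfg b)   ≡⟨ fire-cfg b-valid (canFire-transport v-fires) ⟩
      cfg (inc b v)      ∎
      where open ≡-Reasoning

  transport : ∀ {a b vs a′} → Valid a → Valid b → cfg a ≡ cfg b → Path a vs a′ →
              ∃[ b′ ] Path b vs b′ × cfg a′ ≡ cfg b′ × (∀ w → lookup a′ w + lookup b w ≡ lookup b′ w + lookup a w)
  transport {a} {b} a-valid b-valid a≈b [] = b , [] , a≈b , λ w → +-comm (lookup a w) (lookup b w)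
  transport {a} {b} {a′ = a′} a-valid b-valid a≈b (_∷_ {v = v} v-fires path)
    with v-fires′ ← canFire-transport a-valid b-valid a≈b v-fires
    with b′ , path′ , a′≈b′ , shift ← transport (inc-valid a-valid v-fires) (inc-valid b-valid v-fires′)
                                                (cfg-inc-transport a-valid b-valid a≈b v-fires) path
    = b′ , v-fires′ ∷ path′ , a′≈b′ , λ w → +-cancelʳ-≡ (δ v w) _ _ (shift′ w)
    where
    open ≡-Reasoning
    shift′ : ∀ w → lookup a′ w + lookup b w + δ v w ≡ lookup b′ w + lookup a w + δ v w
    shift′ w = begin
      lookup a′ w + lookup b w + δ v w     ≡⟨ +-assoc (lookup a′ w) (lookup b w) (δ v w) ⟩
      lookup a′ w + (lookup b w + δ v w)   ≡⟨ cong (lookup a′ w +_) (lookup-inc b v w) ⟨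
      lookup a′ w + lookup (inc b v) w     ≡⟨ shift w ⟩
      lookup b′ w + lookup (inc a v) w     ≡⟨ cong (lookup b′ w +_) (lookup-inc a v w) ⟩
      lookup b′ w + (lookup a w + δ v w)   ≡⟨ +-assoc (lookup b′ w) (lookup a w) (δ v w) ⟨
      lookup b′ w + lookup a w + δ v w     ∎

  record Twins (a b : Shot) : Set where
    constructor twins
    field
      base       : Shot
      base-valid : Valid base
      shots-a    : List (Fin n)
      path-a     : Path base shots-a a
      shots-b    : List (Fin n)
      path-b     : Path base shots-b b
      same-cfg   : cfg a ≡ cfg b
      distinct   : a ≢ b

  twins-sym : ∀ {a b} → Twins a b → Twins b a
  twins-sym (twins x x-valid as path-a bs path-b a≈b a≢b) = twins x x-valid bs path-b as path-a (sym a≈b) (a≢b ∘ sym)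

  twins-step : ∀ {a b} → Twins a b → ¬ (b ≤ₛ a) → ∃[ a′ ] ∃[ b′ ] Twins a′ b′ × ∃[ c ] ∃[ cs ] Path a (c ∷ cs) a′
  twins-step {a} {b} (twins x x-valid _ path-a _ path-b a≈b a≢b) b≰a with join path-a path-b
  ... | [] , path-join = ⊥-elim (b≰a b≤a)
    where
    b≤a : b ≤ₛ a
    b≤a w = subst (lookup b w ≤_)
                  (trans (sym (lookup-⊔ₛ a b w)) (cong (λ t → lookup t w) (path-deterministic path-join [])))
                  (m≤n⊔m (lookup a w) (lookup b w))
  ... | c ∷ cs , path-join
    with b′ , path-b′ , a⊔b≈b′ , shift ← transport (path-valid x-valid path-a) (path-valid x-valid path-b) a≈b path-join
    = a ⊔ₛ b , b′ , twins b (path-valid x-valid path-b) _ path-b-join _ path-b′ a⊔b≈b′ a⊔b≢b′ , c , cs , path-join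
    where
    path-b-join : Path b _ (a ⊔ₛ b)
    path-b-join = subst (Path b _) (⊔ₛ-comm b a) (proj₂ (join path-b path-a))
    a⊔b≢b′ : a ⊔ₛ b ≢ b′
    a⊔b≢b′ refl = a≢b (lookup-ext λ w → sym (+-cancelˡ-≡ (lookup b′ w) _ _ (shift w)))

  Reach⁺ : Config n → Config n → Set
  Reach⁺ σ σ′ = ∃[ τ ] Step G σ τ × Reach G τ σ′

  path⇒reach⁺ : ∀ {x v vs y} → Valid x → Path x (v ∷ vs) y → Reach⁺ (cfg x) (cfg y)
  path⇒reach⁺ x-valid (v-fires ∷ path) = _ , fire-step x-valid v-fires , path⇒reach (inc-valid x-valid v-fires) path

  ≤ₛ-antisym : ∀ {x y} → x ≤ₛ y → y ≤ₛ x → x ≡ y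
  ≤ₛ-antisym x≤y y≤x = lookup-ext λ w → ≤-antisym (x≤y w) (y≤x w)

  _≤ₛ?_ : ∀ x y → Dec (x ≤ₛ y)
  x ≤ₛ? y = Finₚ.all? (λ w → lookup x w ≤? lookup y w)

  twins-progress : ∀ {a b} → Twins a b → ∃[ a′ ] ∃[ b′ ] Twins a′ b′ × Reach⁺ (cfg a) (cfg a′)
  twins-progress {a} {b} tw@(twins x x-valid _ path-a _ path-b a≈b a≢b) with b ≤ₛ? a
  ... | no b≰a with a′ , b′ , tw′ , _ , _ , path ← twins-step tw b≰a =
    a′ , b′ , tw′ , path⇒reach⁺ (path-valid x-valid path-a) path
  ... | yes b≤a with a′ , b′ , tw′ , _ , _ , path ← twins-step (twins-sym tw) (a≢b ∘ flip ≤ₛ-antisym b≤a) =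
    a′ , b′ , tw′ , subst (λ σ → Reach⁺ σ (cfg a′)) (sym a≈b) (path⇒reach⁺ (path-valid x-valid path-b) path)

  prefix : ∀ {x vs y} → Path x vs y → (i : Fin (suc (length vs))) → ∃[ ws ] ∃[ z ] Path x ws z × length ws ≡ toℕ i
  prefix path             Fin.zero    = [] , _ , [] , refl
  prefix (v-fires ∷ path) (Fin.suc i) with ws , z , path′ , len ← prefix path i = _ ∷ ws , z , v-fires ∷ path′ , cong suc len

  ∣reachable∣ : ∀ {vs x} → Path zeros vs x → ∣ x ∣ ≡ length vs
  ∣reachable∣ {vs} path = trans (path-length path) (cong (_+ length vs) ∣zeros∣)

  module Convergence (convergent : Convergent G σ₀) where

    cfg-injective : ∀ {a b} → Reachable a → Reachable b → cfg a ≡ cfg b → a ≡ b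
    cfg-injective {a} {b} (as , path-a) (bs , path-b) a≈b with a ≟ᵥ b
    ... | yes a≡b = a≡b
    ... | no a≢b  = ⊥-elim (convergent (recurrent⇒infinite (Step G) TwinCfg progress (reachable⇒reach (as , path-a))
                                                           (a , b , twins zeros zeros-valid as path-a bs path-b a≈b a≢b , refl)))
      where
      TwinCfg : Config n → Set
      TwinCfg σ = ∃[ a ] ∃[ b ] Twins a b × cfg a ≡ σ
      progress : ∀ {σ} → TwinCfg σ → ∃[ σ′ ] TwinCfg σ′ × Reach⁺ σ σ′
      progress (a , b , tw , refl) with a′ , b′ , tw′ , a→a′ ← twins-progress tw =
        cfg a′ , (a′ , b′ , tw′ , refl) , a→a′

    K : ℕ
    K = suc (chips G σ₀) ^ n

    module _ {vs y} (path : Path zeros vs y) where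

      endpoint : Fin (suc (length vs)) → Shot
      endpoint i = proj₁ (proj₂ (prefix path i))

      endpoint-path : ∀ i → Path zeros _ (endpoint i)
      endpoint-path i = proj₁ (proj₂ (proj₂ (prefix path i)))

      ∣endpoint∣ : ∀ i → ∣ endpoint i ∣ ≡ toℕ i
      ∣endpoint∣ i = trans (∣reachable∣ (endpoint-path i)) (proj₂ (proj₂ (proj₂ (prefix path i))))

      endpoint-code-injective : ∀ i j → code (chips G σ₀) (cfg (endpoint i)) ≡ code (chips G σ₀) (cfg (endpoint j)) →
                                toℕ i ≡ toℕ j
      endpoint-code-injective i j same-code = begin
        toℕ i            ≡⟨ ∣endpoint∣ i ⟨
        ∣ endpoint i ∣   ≡⟨ cong ∣_∣ (cfg-injective (_ , endpoint-path i) (_ , endpoint-path j)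
                                        (code-injective _ (bounded i) (bounded j) same-code)) ⟩
        ∣ endpoint j ∣   ≡⟨ ∣endpoint∣ j ⟩
        toℕ j            ∎
        where
        open ≡-Reasoning
        bounded : ∀ i w → lookup (cfg (endpoint i)) w ≤ chips G σ₀
        bounded i = reach-bounded G (reachable⇒reach (_ , endpoint-path i))

    path-length< : ∀ {vs y} → Path zeros vs y → length vs < K
    path-length< {vs} path with length vs <? K
    ... | yes short = short
    ... | no long
      with i , j , i<j , same-code ← Finₚ.pigeonhole (s≤s (≮⇒≥ long)) (code (chips G σ₀) ∘ cfg ∘ endpoint path)
      = ⊥-elim (<-irrefl (endpoint-code-injective path i j same-code) i<j)

    reachable-< : ∀ {x} → Reachable x → ∀ w → lookup x w < K
    reachable-< {x} (vs , path) w =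
      ≤-<-trans (≤-sum (lookup x) w) (subst (_< K) (sym (∣reachable∣ path)) (path-length< path))

    search : (P : Shot → Set) → (∀ x → Dec (P x)) → Dec (∃[ x ] Reachable x × P x)
    search P P? = map′ (λ (vs , _ , x , path , Px) → x , (vs , path) , Px)
                       (λ (x , (vs , path) , Px) → vs , <⇒≤ (path-length< path) , x , path , Px)
                       (∃-list≤? K (λ vs → ∃[ x ] Path zeros vs x × P x) ends-in-P?)
      where
      ends-in-P? : ∀ vs → Dec (∃[ x ] Path zeros vs x × P x)
      ends-in-P? vs with path? zeros vs
      ... | no ¬path = no λ (x , path , _) → ¬path (x , path)
      ... | yes (x , path) = map′ (λ Px → x , path , Px)
                                  (λ (x′ , path′ , Px′) → subst P (path-deterministic path′ path) Px′) (P? x)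

    -- zeros is a junk value, returned when no reachable witness exists.
    choose : {P : Shot → Set} → Dec (∃[ x ] Reachable x × P x) → Shot
    choose (yes (x , _)) = x
    choose (no _)        = zeros

    choose-unique : ∀ {P : Shot → Set} (found? : Dec (∃[ x ] Reachable x × P x)) →
                    (∀ {x y} → Reachable x → Reachable y → P x → P y → x ≡ y) →
                    ∀ {x} → Reachable x → P x → choose found? ≡ x
    choose-unique (yes (x′ , x′-reachable , Px′)) unique x-reachable Px = unique x′-reachable x-reachable Px′ Px
    choose-unique (no nothing)                   unique x-reachable Px = ⊥-elim (nothing (_ , x-reachable , Px))

    module _ {k} (f : Shot → Vec ℕ k) where

      unapply : Vec ℕ k → Shot
      unapply c = choose (search (λ x → f x ≡ c) (λ x → f x ≟ᵥ c))

      unapply-apply : (∀ {x y} → Reachable x → Reachable y → f x ≡ f y → x ≡ y) →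
                      ∀ {x} → Reachable x → unapply (f x) ≡ x
      unapply-apply f-injective {x} x-reachable =
        choose-unique (search (λ y → f y ≡ f x) (λ y → f y ≟ᵥ f x))
                      (λ u-reachable v-reachable fu≡fx fv≡fx → f-injective u-reachable v-reachable (trans fu≡fx (sym fv≡fx)))
                      x-reachable refl

record Parametrisation {n m} (G : Graph n) (σ₀ : Config n) (H : Graph m) (τ₀ : Config m) : Set₁ where
  field
    State       : Set
    Reachable   : State → Set
    cfgG        : State → Config n
    cfgH        : State → Config m
    cfgG⁻¹      : Config n → State
    cfgH⁻¹      : Config m → State
    cfgG⁻¹-cfgG : ∀ {x} → Reachable x → cfgG⁻¹ (cfgG x) ≡ x
    cfgH⁻¹-cfgH : ∀ {x} → Reachable x → cfgH⁻¹ (cfgH x) ≡ x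
    reachG      : ∀ {x} → Reachable x → Reach G σ₀ (cfgG x)
    reachH      : ∀ {x} → Reachable x → Reach H τ₀ (cfgH x)
    reachG⁻¹    : ∀ {σ} → Reach G σ₀ σ → ∃[ x ] Reachable x × cfgG x ≡ σ
    reachH⁻¹    : ∀ {τ} → Reach H τ₀ τ → ∃[ x ] Reachable x × cfgH x ≡ τ
    order       : ∀ {x y} → Reachable x → Reachable y → Reach G (cfgG x) (cfgG y) ⇔ Reach H (cfgH x) (cfgH y)

parametrisation⇒equivalent : ∀ {n m} {G : Graph n} {σ₀ : Config n} {H : Graph m} {τ₀ : Config m} →
                             Parametrisation G σ₀ H τ₀ → Equivalent G σ₀ H τ₀
parametrisation⇒equivalent {G = G} {σ₀} {H} {τ₀} P = record
  { to         = cfgH ∘ cfgG⁻¹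
  ; from       = cfgG ∘ cfgH⁻¹
  ; to-reach   = to-reach
  ; from-reach = from-reach
  ; from-to    = from-to
  ; to-from    = to-from
  ; order      = order′
  }
  where
  open Parametrisation P

  to-reach : ∀ σ → Reach G σ₀ σ → Reach H τ₀ (cfgH (cfgG⁻¹ σ))
  to-reach σ steps with x , x-reachable , refl ← reachG⁻¹ steps =
    subst (Reach H τ₀ ∘ cfgH) (sym (cfgG⁻¹-cfgG x-reachable)) (reachH x-reachable)

  from-reach : ∀ τ → Reach H τ₀ τ → Reach G σ₀ (cfgG (cfgH⁻¹ τ))
  from-reach τ steps with x , x-reachable , refl ← reachH⁻¹ steps =
    subst (Reach G σ₀ ∘ cfgG) (sym (cfgH⁻¹-cfgH x-reachable)) (reachG x-reachable)

  from-to : ∀ σ → Reach G σ₀ σ → cfgG (cfgH⁻¹ (cfgH (cfgG⁻¹ σ))) ≡ σ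
  from-to σ steps with x , x-reachable , refl ← reachG⁻¹ steps
    rewrite cfgG⁻¹-cfgG x-reachable | cfgH⁻¹-cfgH x-reachable = refl

  to-from : ∀ τ → Reach H τ₀ τ → cfgH (cfgG⁻¹ (cfgG (cfgH⁻¹ τ))) ≡ τ
  to-from τ steps with x , x-reachable , refl ← reachH⁻¹ steps
    rewrite cfgH⁻¹-cfgH x-reachable | cfgG⁻¹-cfgG x-reachable = refl

  order′ : ∀ σ σ′ → Reach G σ₀ σ → Reach G σ₀ σ′ → Reach G σ σ′ ⇔ Reach H (cfgH (cfgG⁻¹ σ)) (cfgH (cfgG⁻¹ σ′))
  order′ σ σ′ steps steps′
    with x , x-reachable , refl ← reachG⁻¹ steps
    with y , y-reachable , refl ← reachG⁻¹ steps′
    rewrite cfgG⁻¹-cfgG x-reachable | cfgG⁻¹-cfgG y-reachable = order x-reachable y-reachable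

-- After a vertex has fired t times, its copy k has fired (fired k t) times and has received
-- (chained k t) transfers of W chips from copy k - 1.
fired : ℕ → ℕ → ℕ
fired k t = ⟦ k <? t ⟧

chained : ℕ → ℕ → ℕ
chained zero    t = 0
chained (suc k) t = fired k t

signum : ℕ → ℕ
signum zero    = 0
signum (suc _) = 1

fired-< : ∀ {k t} → k < t → fired k t ≡ 1
fired-< {k} {t} = ⟦⟧-yes (k <? t)

fired-≥ : ∀ {k t} → t ≤ k → fired k t ≡ 0
fired-≥ {k} {t} t≤k = ⟦⟧-no (k <? t) (≤⇒≯ t≤k)

fired-+1 : ∀ k t → fired k (t + 1) ≡ fired k t + ⟦ k ≟ t ⟧
fired-+1 k t with <-cmp k t
... | tri< k<t k≢t _ =
  trans (fired-< (≤-trans k<t (m≤m+n t 1))) (sym (cong₂ _+_ (fired-< k<t) (⟦⟧-no (k ≟ t) k≢t)))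
... | tri≈ _ refl _ =
  trans (fired-< (≤-reflexive (+-comm 1 k))) (sym (cong₂ _+_ (fired-≥ ≤-refl) (⟦⟧-yes (k ≟ k) refl)))
... | tri> _ k≢t t<k =
  trans (fired-≥ (subst (_≤ k) (+-comm 1 t) t<k)) (sym (cong₂ _+_ (fired-≥ (<⇒≤ t<k)) (⟦⟧-no (k ≟ t) k≢t)))

chained-+1 : ∀ k t → chained k (t + 1) ≡ chained k t + ⟦ k ≟ suc t ⟧
chained-+1 zero    t = sym (⟦⟧-no (0 ≟ suc t) (λ ()))
chained-+1 (suc k) t = trans (fired-+1 k t) (cong (fired k t +_) (⟦⟧-cong (k ≟ t) (suc k ≟ suc t) (cong suc) suc-injective))

chained-≤ : ∀ {k t} → k ≤ t → chained k t ≡ signum k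
chained-≤ {zero}  _   = refl
chained-≤ {suc k} k<t = fired-< k<t

chained-> : ∀ {k t} → t < k → chained k t ≡ 0
chained-> {suc k} (s≤s t≤k) = fired-≥ t≤k

chained-0 : ∀ k → chained k 0 ≡ 0
chained-0 zero    = refl
chained-0 (suc k) = fired-≥ {k} z≤n

private
  +-reassoc : ∀ a b c d → (a + b) + (c + d) ≡ a + ((b + c) + d)
  +-reassoc a b c d = trans (+-assoc a b (c + d)) (cong (a +_) (sym (+-assoc b c d)))

  double-reassoc : ∀ a d e → a * 2 + (d + e) ≡ a + ((a + d) + e)
  double-reassoc = solve-∀

-- The firing condition of copy k of w with both sides shifted by its cost (copy-canFire⇔),
-- in the three cases k = x w, k < x w and k > x w.
copy-fires-now⇔ : ∀ O s g D E → O * 1 + (D + E) ≤ (O + s) + (g + E) ⇔ D ≤ s + g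
copy-fires-now⇔ O s g D E = mk⇔
  (λ fires → +-cancelʳ-≤ E _ _ (+-cancelˡ-≤ O _ _ (subst₂ _≤_ (cong (_+ (D + E)) (*-identityʳ O)) (+-reassoc O s g E) fires)))
  (λ D≤sg → subst₂ _≤_ (cong (_+ (D + E)) (sym (*-identityʳ O))) (sym (+-reassoc O s g E)) (+-monoʳ-≤ O (+-monoˡ-≤ E D≤sg)))

copy-fires-early : ∀ O s g D E {W} → s + g < W → W ≤ O → ¬ (O * 2 + (D + E) ≤ (O + s) + (g + E))
copy-fires-early O s g D E sg<W W≤O fires = <-irrefl refl (<-≤-trans (≤-<-trans O≤sg sg<W) W≤O)
  where
  O+D≤sg : O + D ≤ s + g
  O+D≤sg = +-cancelʳ-≤ E _ _ (+-cancelˡ-≤ O _ _ (subst₂ _≤_ (double-reassoc O D E) (+-reassoc O s g E) fires))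
  O≤sg : O ≤ s + g
  O≤sg = m+n≤o⇒m≤o O O+D≤sg

copy-fires-late : ∀ O s g D {W} → s + g < W → ¬ (O * 1 + (D + W * 1) ≤ (O + s) + (g + W * 0))
copy-fires-late O s g D {W} sg<W fires = <⇒≱ sg<W (m+n≤o⇒n≤o D D+W≤sg)
  where
  D+W≤sg : D + W ≤ s + g
  D+W≤sg = Equivalence.to (copy-fires-now⇔ O s g (D + W) 0)
             (subst₂ _≤_ (cong (λ e → O * 1 + e) (trans (cong (D +_) (*-identityʳ W)) (sym (+-identityʳ (D + W)))))
                         (cong (λ e → (O + s) + (g + e)) (*-zeroʳ W)) fires)

module Splitting {n} (G : Graph n) (σ₀ : Config n) (convergent : Convergent G σ₀) where

  open ShotVectors G σ₀
  open ShotVectors.Convergence G σ₀ convergent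

  W : ℕ
  W = suc (sum (λ w → lookup σ₀ w + sum (λ u → G u w * K)))

  m : ℕ
  m = suc (n * K)

  split : Fin (n * K) → Fin n × Fin K
  split = remQuot K

  copy : Fin n → Fin K → Fin m
  copy v i = Fin.suc (combine v i)

  data View : Fin m → Set where
    sink    : View Fin.zero
    copy-of : ∀ w k → View (copy w k)

  view : ∀ p → View p
  view Fin.zero    = sink
  view (Fin.suc q) = subst View (cong Fin.suc (Finₚ.combine-remQuot {n} K q)) (copy-of (proj₁ (split q)) (proj₂ (split q)))

  copy-injective : ∀ {v i w k} → copy v i ≡ copy w k → v ≡ w × i ≡ k
  copy-injective {v} {i} {w} {k} eq = Finₚ.combine-injective v i w k (Finₚ.suc-injective eq)

  copy-edges : Fin n × Fin K → Fin n × Fin K → ℕ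
  copy-edges (v , i) (w , k) = G v w + W * (δ v w * ⟦ toℕ k ≟ suc (toℕ i) ⟧)

  copy-outdeg : Fin (n * K) → ℕ
  copy-outdeg p = sum (λ q → copy-edges (split p) (split q))

  Out : ℕ
  Out = sum copy-outdeg + (sum (λ w → d w * K) + W)

  sink-capacity : ℕ
  sink-capacity = sum (λ p → Out ∸ copy-outdeg p)

  H : Graph m
  H Fin.zero    Fin.zero    = suc sink-capacity
  H Fin.zero    (Fin.suc q) = 0
  H (Fin.suc p) Fin.zero    = Out ∸ copy-outdeg p
  H (Fin.suc p) (Fin.suc q) = copy-edges (split p) (split q)

  cost : Fin n → Fin K → ℕ
  cost w k = d w * suc (toℕ k) + W * signum (toℕ k)

  copy-init : Fin n → Fin K → ℕ
  copy-init w k = (Out + lookup σ₀ w) ∸ cost w k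

  init : Fin m → ℕ
  init Fin.zero    = 0
  init (Fin.suc q) = copy-init (proj₁ (split q)) (proj₂ (split q))

  τ₀ : Config m
  τ₀ = tabulate init

  encoding : Shot → Fin m → ℕ
  encoding x Fin.zero    = 0
  encoding x (Fin.suc q) = fired (toℕ (proj₂ (split q))) (lookup x (proj₁ (split q)))

  encode : Shot → Vec ℕ m
  encode x = tabulate (encoding x)

  module TH = ShotVectors H τ₀

  split-copy : ∀ w k → split (combine w k) ≡ (w , k)
  split-copy = Finₚ.remQuot-combine

  lookup-encode-copy : ∀ x w k → lookup (encode x) (copy w k) ≡ fired (toℕ k) (lookup x w)
  lookup-encode-copy x w k =
    trans (lookup∘tabulate (encoding x) (copy w k)) (cong (λ (v , i) → fired (toℕ i) (lookup x v)) (split-copy w k))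

  lookup-encode-sink : ∀ x → lookup (encode x) Fin.zero ≡ 0
  lookup-encode-sink x = lookup∘tabulate (encoding x) Fin.zero

  encode-≤1 : ∀ x p → lookup (encode x) p ≤ 1
  encode-≤1 x p with view p
  ... | sink         = ≤-trans (≤-reflexive (lookup-encode-sink x)) z≤n
  ... | copy-of w k  = subst (_≤ 1) (sym (lookup-encode-copy x w k)) (⟦⟧≤1 _)

  H-copy-copy : ∀ v i w k → H (copy v i) (copy w k) ≡ G v w + W * (δ v w * ⟦ toℕ k ≟ suc (toℕ i) ⟧)
  H-copy-copy v i w k = cong₂ copy-edges (split-copy v i) (split-copy w k)

  lookup-τ₀-copy : ∀ w k → lookup τ₀ (copy w k) ≡ copy-init w k
  lookup-τ₀-copy w k = trans (lookup∘tabulate init (copy w k)) (cong (λ (v , i) → copy-init v i) (split-copy w k))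

  outdeg-copy : ∀ p → outdeg H (Fin.suc p) ≡ Out
  outdeg-copy p = trans (outdeg-sum H (Fin.suc p)) (m∸n+n≡m (≤-trans (≤-sum copy-outdeg p) (m≤m+n _ _)))

  outdeg-sink : outdeg H Fin.zero ≡ suc sink-capacity
  outdeg-sink = trans (outdeg-sum H Fin.zero)
                      (trans (cong (suc sink-capacity +_) (sum-zero {f = λ q → H Fin.zero (Fin.suc q)} (λ _ → refl))) (+-identityʳ _))

  encode-zeros : encode zeros ≡ TH.zeros
  encode-zeros = lookup-ext pointwise
    where
    pointwise : ∀ p → lookup (encode zeros) p ≡ lookup TH.zeros p
    pointwise p with view p
    ... | sink        = trans (lookup-encode-sink zeros) (sym (TH.lookup-zeros Fin.zero))
    ... | copy-of w k = begin
      lookup (encode zeros) (copy w k)   ≡⟨ lookup-encode-copy zeros w k ⟩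
      fired (toℕ k) (lookup zeros w)     ≡⟨ cong (fired (toℕ k)) (lookup-zeros w) ⟩
      fired (toℕ k) 0                    ≡⟨ fired-≥ {toℕ k} z≤n ⟩
      0                                  ≡⟨ TH.lookup-zeros (copy w k) ⟨
      lookup TH.zeros (copy w k)         ∎
      where open ≡-Reasoning

  encode-inc : ∀ x v k → toℕ k ≡ lookup x v → encode (inc x v) ≡ TH.inc (encode x) (copy v k)
  encode-inc x v k k≡xv = lookup-ext pointwise
    where
    open ≡-Reasoning
    at-copy : ∀ w j → Dec (w ≡ v) →
              fired (toℕ j) (lookup x w + δ v w) ≡ fired (toℕ j) (lookup x w) + δ (copy v k) (copy w j)
    at-copy w j (yes refl) = begin
      fired (toℕ j) (lookup x w + δ w w)                         ≡⟨ cong (λ e → fired (toℕ j) (lookup x w + e)) (δ-same w) ⟩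
      fired (toℕ j) (lookup x w + 1)                             ≡⟨ fired-+1 (toℕ j) (lookup x w) ⟩
      fired (toℕ j) (lookup x w) + ⟦ toℕ j ≟ lookup x w ⟧        ≡⟨ cong (fired (toℕ j) (lookup x w) +_) (⟦⟧-cong _ _ j≡k k≡j) ⟩
      fired (toℕ j) (lookup x w) + δ (copy w k) (copy w j)       ∎
      where
      j≡k : toℕ j ≡ lookup x w → copy w j ≡ copy w k
      j≡k j≡xw = cong (copy w) (Finₚ.toℕ-injective (trans j≡xw (sym k≡xv)))
      k≡j : copy w j ≡ copy w k → toℕ j ≡ lookup x w
      k≡j eq = trans (cong toℕ (proj₂ (copy-injective eq))) k≡xv
    at-copy w j (no w≢v) = begin
      fired (toℕ j) (lookup x w + δ v w)                     ≡⟨ cong (λ e → fired (toℕ j) (lookup x w + e)) (δ-other w≢v) ⟩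
      fired (toℕ j) (lookup x w + 0)                         ≡⟨ cong (fired (toℕ j)) (+-identityʳ _) ⟩
      fired (toℕ j) (lookup x w)                             ≡⟨ +-identityʳ _ ⟨
      fired (toℕ j) (lookup x w) + 0                         ≡⟨ cong (fired (toℕ j) (lookup x w) +_) (δ-other (w≢v ∘ proj₁ ∘ copy-injective)) ⟨
      fired (toℕ j) (lookup x w) + δ (copy v k) (copy w j)   ∎
    pointwise : ∀ p → lookup (encode (inc x v)) p ≡ lookup (TH.inc (encode x) (copy v k)) p
    pointwise p with view p
    ... | sink = begin
      lookup (encode (inc x v)) Fin.zero                          ≡⟨ lookup-encode-sink (inc x v) ⟩
      0                                                           ≡⟨ cong₂ _+_ (lookup-encode-sink x) (δ-other {v = copy v k} {w = Fin.zero} (λ ())) ⟨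
      lookup (encode x) Fin.zero + δ (copy v k) Fin.zero          ≡⟨ TH.lookup-inc (encode x) (copy v k) Fin.zero ⟨
      lookup (TH.inc (encode x) (copy v k)) Fin.zero              ∎
    ... | copy-of w j = begin
      lookup (encode (inc x v)) (copy w j)                        ≡⟨ lookup-encode-copy (inc x v) w j ⟩
      fired (toℕ j) (lookup (inc x v) w)                          ≡⟨ cong (fired (toℕ j)) (lookup-inc x v w) ⟩
      fired (toℕ j) (lookup x w + δ v w)                          ≡⟨ at-copy w j (w Finₚ.≟ v) ⟩
      fired (toℕ j) (lookup x w) + δ (copy v k) (copy w j)        ≡⟨ cong (_+ _) (lookup-encode-copy x w j) ⟨
      lookup (encode x) (copy w j) + δ (copy v k) (copy w j)      ≡⟨ TH.lookup-inc (encode x) (copy v k) (copy w j) ⟨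
      lookup (TH.inc (encode x) (copy v k)) (copy w j)            ∎

  GainFormula : Shot → Set
  GainFormula x = ∀ w k → TH.gain (encode x) (copy w k) ≡ gain x w + W * chained (toℕ k) (lookup x w)

  gain-formula-zeros : GainFormula zeros
  gain-formula-zeros w k = begin
    TH.gain (encode zeros) (copy w k)                      ≡⟨ cong (λ z → TH.gain z (copy w k)) encode-zeros ⟩
    TH.gain TH.zeros (copy w k)                            ≡⟨ TH.gain-zeros (copy w k) ⟩
    0                                                      ≡⟨ *-zeroʳ W ⟨
    W * 0                                                  ≡⟨ cong (W *_) (chained-0 (toℕ k)) ⟨
    0 + W * chained (toℕ k) 0                              ≡⟨ cong₂ (λ g t → g + W * chained (toℕ k) t) (gain-zeros w) (lookup-zeros w) ⟨
    gain zeros w + W * chained (toℕ k) (lookup zeros w)    ∎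
    where open ≡-Reasoning

  gain-formula-inc : ∀ {x v} k → toℕ k ≡ lookup x v → GainFormula x → GainFormula (inc x v)
  gain-formula-inc {x} {v} k k≡xv formula w j = begin
    TH.gain (encode (inc x v)) (copy w j)
      ≡⟨ cong (λ z → TH.gain z (copy w j)) (encode-inc x v k k≡xv) ⟩
    TH.gain (TH.inc (encode x) (copy v k)) (copy w j)
      ≡⟨ TH.gain-inc (encode x) (copy v k) (copy w j) ⟩
    TH.gain (encode x) (copy w j) + H (copy v k) (copy w j)
      ≡⟨ cong₂ _+_ (formula w j) (H-copy-copy v k w j) ⟩
    (gain x w + W * chained (toℕ j) (lookup x w)) + (G v w + W * (δ v w * link))
      ≡⟨ interchange (gain x w) _ (G v w) _ ⟩
    (gain x w + G v w) + (W * chained (toℕ j) (lookup x w) + W * (δ v w * link))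
      ≡⟨ cong₂ _+_ (gain-inc x v w) (*-distribˡ-+ W (chained (toℕ j) (lookup x w)) (δ v w * link)) ⟨
    gain (inc x v) w + W * (chained (toℕ j) (lookup x w) + δ v w * link)
      ≡⟨ cong (λ c → gain (inc x v) w + W * c) (chained-inc (w Finₚ.≟ v)) ⟩
    gain (inc x v) w + W * chained (toℕ j) (lookup (inc x v) w) ∎
    where
    open ≡-Reasoning
    link : ℕ
    link = ⟦ toℕ j ≟ suc (toℕ k) ⟧
    chained-inc : Dec (w ≡ v) → chained (toℕ j) (lookup x w) + δ v w * link ≡ chained (toℕ j) (lookup (inc x v) w)
    chained-inc (yes refl) = begin
      chained (toℕ j) (lookup x w) + δ w w * link               ≡⟨ cong (λ e → chained (toℕ j) (lookup x w) + e * link) (δ-same w) ⟩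
      chained (toℕ j) (lookup x w) + (link + 0)                 ≡⟨ cong (chained (toℕ j) (lookup x w) +_) (+-identityʳ link) ⟩
      chained (toℕ j) (lookup x w) + link                       ≡⟨ cong (λ t → chained (toℕ j) (lookup x w) + ⟦ toℕ j ≟ suc t ⟧) k≡xv ⟩
      chained (toℕ j) (lookup x w) + ⟦ toℕ j ≟ suc (lookup x w) ⟧ ≡⟨ chained-+1 (toℕ j) (lookup x w) ⟨
      chained (toℕ j) (lookup x w + 1)                          ≡⟨ cong (chained (toℕ j)) (trans (lookup-inc-same x w) (+-comm 1 (lookup x w))) ⟨
      chained (toℕ j) (lookup (inc x w) w)                      ∎
    chained-inc (no w≢v) = begin
      chained (toℕ j) (lookup x w) + δ v w * link   ≡⟨ cong (λ e → chained (toℕ j) (lookup x w) + e * link) (δ-other w≢v) ⟩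
      chained (toℕ j) (lookup x w) + 0              ≡⟨ +-identityʳ _ ⟩
      chained (toℕ j) (lookup x w)                  ≡⟨ cong (chained (toℕ j)) (lookup-inc-other x w≢v) ⟨
      chained (toℕ j) (lookup (inc x v) w)          ∎

  next-copy : ∀ {x} → Reachable x → Fin n → Fin K
  next-copy x-reachable v = fromℕ< (reachable-< x-reachable v)

  toℕ-next-copy : ∀ {x} (x-reachable : Reachable x) v → toℕ (next-copy x-reachable v) ≡ lookup x v
  toℕ-next-copy x-reachable v = Finₚ.toℕ-fromℕ< (reachable-< x-reachable v)

  gain-encode : ∀ {x} → Reachable x → GainFormula x
  gain-encode (_ , path) = go ([] , []) path gain-formula-zeros
    where
    go : ∀ {z vs x} → Reachable z → Path z vs x → GainFormula z → GainFormula x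
    go     z-reachable []                         formula = formula
    go {z} z-reachable (_∷_ {v = v} v-fires path) formula =
      go (reachable-path z-reachable (v-fires ∷ [])) path
         (gain-formula-inc {z} {v} (next-copy z-reachable v) (toℕ-next-copy z-reachable v) formula)

  W-large : ∀ {x} → Reachable x → ∀ w → lookup σ₀ w + gain x w < W
  W-large {x} x-reachable w = s≤s (≤-trans (+-monoʳ-≤ (lookup σ₀ w) (sum-mono-≤ λ u → *-monoʳ-≤ (G u w) (<⇒≤ (reachable-< x-reachable u))))
                                           (≤-sum (λ w → lookup σ₀ w + sum (λ u → G u w * K)) w))

  W≤Out : W ≤ Out
  W≤Out = ≤-trans (m≤n+m W _) (m≤n+m _ (sum copy-outdeg))

  cost≤Out : ∀ w k → cost w k ≤ Out
  cost≤Out w k = ≤-trans (+-mono-≤ (≤-trans (*-monoʳ-≤ (d w) (Finₚ.toℕ<n k)) (≤-sum (λ w → d w * K) w)) (W*signum≤W (toℕ k)))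
                         (m≤n+m _ (sum copy-outdeg))
    where
    W*signum≤W : ∀ j → W * signum j ≤ W
    W*signum≤W zero    = subst (_≤ W) (sym (*-zeroʳ W)) z≤n
    W*signum≤W (suc j) = ≤-reflexive (*-identityʳ W)

  copy-init-balance : ∀ w k → copy-init w k + cost w k ≡ Out + lookup σ₀ w
  copy-init-balance w k = m∸n+n≡m (≤-trans (cost≤Out w k) (m≤m+n Out _))

  copy-canFire⇔ : ∀ {x} → Reachable x → ∀ w k {f c e} →
                  fired (toℕ k) (lookup x w) ≡ f → chained (toℕ k) (lookup x w) ≡ c → signum (toℕ k) ≡ e →
                  TH.CanFire (encode x) (copy w k) ⇔
                  Out * suc f + (d w * suc (toℕ k) + W * e) ≤ (Out + lookup σ₀ w) + (gain x w + W * c)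
  copy-canFire⇔ {x} x-reachable w k refl refl refl = mk⇔
    (λ (TH.canFire fires) → subst (Out * suc (fired (toℕ k) (lookup x w)) + cost w k ≤_) shifted
                                    (+-monoˡ-≤ (cost w k) (subst₂ _≤_ lhs rhs fires)))
    (λ fires → TH.canFire (subst₂ _≤_ (sym lhs) (sym rhs)
                 (+-cancelʳ-≤ (cost w k) _ _ (subst (Out * suc (fired (toℕ k) (lookup x w)) + cost w k ≤_) (sym shifted) fires))))
    where
    lhs : outdeg H (copy w k) * suc (lookup (encode x) (copy w k)) ≡ Out * suc (fired (toℕ k) (lookup x w))
    lhs = cong₂ (λ o f → o * suc f) (outdeg-copy (combine w k)) (lookup-encode-copy x w k)
    rhs : lookup τ₀ (copy w k) + TH.gain (encode x) (copy w k) ≡ copy-init w k + (gain x w + W * chained (toℕ k) (lookup x w))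
    rhs = cong₂ _+_ (lookup-τ₀-copy w k) (gain-encode x-reachable w k)
    shifted : copy-init w k + (gain x w + W * chained (toℕ k) (lookup x w)) + cost w k
              ≡ (Out + lookup σ₀ w) + (gain x w + W * chained (toℕ k) (lookup x w))
    shifted = trans (xy∙z≈xz∙y (copy-init w k) (gain x w + W * chained (toℕ k) (lookup x w)) (cost w k))
                    (cong (_+ (gain x w + W * chained (toℕ k) (lookup x w))) (copy-init-balance w k))

  copy-on-time⇔ : ∀ {x w k} → Reachable x → toℕ k ≡ lookup x w → TH.CanFire (encode x) (copy w k) ⇔ CanFire x w
  copy-on-time⇔ {x} {w} {k} x-reachable k≡t = mk⇔
    (λ fires → canFire (subst G-threshold k≡t (Equivalence.to now (Equivalence.to on-time fires))))
    (λ (canFire w-affordable) → Equivalence.from on-time (Equivalence.from now (subst G-threshold (sym k≡t) w-affordable)))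
    where
    G-threshold : ℕ → Set
    G-threshold t = d w * suc t ≤ lookup σ₀ w + gain x w
    on-time : TH.CanFire (encode x) (copy w k) ⇔
              Out * 1 + cost w k ≤ (Out + lookup σ₀ w) + (gain x w + W * signum (toℕ k))
    on-time = copy-canFire⇔ x-reachable w k (fired-≥ (≤-reflexive (sym k≡t))) (chained-≤ (≤-reflexive k≡t)) refl
    now : Out * 1 + cost w k ≤ (Out + lookup σ₀ w) + (gain x w + W * signum (toℕ k)) ⇔ G-threshold (toℕ k)
    now = copy-fires-now⇔ Out (lookup σ₀ w) (gain x w) (d w * suc (toℕ k)) (W * signum (toℕ k))

  copy-fires⇒ : ∀ {x w k} → Reachable x → TH.CanFire (encode x) (copy w k) → toℕ k ≡ lookup x w × CanFire x w
  copy-fires⇒ {x} {w} {k} x-reachable fires with <-cmp (toℕ k) (lookup x w)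
  ... | tri< k<t _ _ =
    ⊥-elim (copy-fires-early Out (lookup σ₀ w) (gain x w) (d w * suc (toℕ k)) (W * signum (toℕ k)) (W-large x-reachable w) W≤Out
              (Equivalence.to (copy-canFire⇔ x-reachable w k (fired-< k<t) (chained-≤ (<⇒≤ k<t)) refl) fires))
  ... | tri≈ _ k≡t _ = k≡t , Equivalence.to (copy-on-time⇔ x-reachable k≡t) fires
  ... | tri> _ _ t<k =
    ⊥-elim (copy-fires-late Out (lookup σ₀ w) (gain x w) (d w * suc (toℕ k)) (W-large x-reachable w)
              (Equivalence.to (copy-canFire⇔ x-reachable w k (fired-≥ (<⇒≤ t<k)) (chained-> t<k) (signum-pos t<k)) fires))
    where
    signum-pos : ∀ {j} → lookup x w < j → signum j ≡ 1
    signum-pos {suc j} _ = refl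

  sink-gain : ∀ x → TH.gain (encode x) Fin.zero ≤ sink-capacity
  sink-gain x = begin
    H Fin.zero Fin.zero * 0 + sum (λ q → (Out ∸ copy-outdeg q) * lookup (encode x) (Fin.suc q))
      ≡⟨ cong (_+ sum (λ q → (Out ∸ copy-outdeg q) * lookup (encode x) (Fin.suc q))) (*-zeroʳ (H Fin.zero Fin.zero)) ⟩
    sum (λ q → (Out ∸ copy-outdeg q) * lookup (encode x) (Fin.suc q))
      ≤⟨ sum-mono-≤ (λ q → ≤-trans (*-monoʳ-≤ (Out ∸ copy-outdeg q) (encode-≤1 x (Fin.suc q))) (≤-reflexive (*-identityʳ _))) ⟩
    sink-capacity ∎
    where open ≤-Reasoning

  sink-never-fires : ∀ x → ¬ TH.CanFire (encode x) Fin.zero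
  sink-never-fires x (TH.canFire fires) =
    <⇒≱ (s≤s (sink-gain x)) (subst (_≤ TH.gain (encode x) Fin.zero) (trans (cong (_* 1) outdeg-sink) (*-identityʳ _)) fires)

  canFireH⇒ : ∀ {x p} → Reachable x → TH.CanFire (encode x) p →
              ∃[ v ] ∃[ k ] p ≡ copy v k × toℕ k ≡ lookup x v × CanFire x v
  canFireH⇒ {x} {p} x-reachable fires with view p
  ... | sink = ⊥-elim (sink-never-fires x fires)
  ... | copy-of w k with k≡t , w-fires ← copy-fires⇒ x-reachable fires = w , k , refl , k≡t , w-fires

  simulate : ∀ {x vs y} → Reachable x → Path x vs y → ∃[ ws ] TH.Path (encode x) ws (encode y)
  simulate x-reachable [] = [] , TH.[]
  simulate {x} x-reachable (_∷_ {v = v} {vs} {y} v-fires path)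
    with ws , pathH ← simulate (reachable-path x-reachable (v-fires ∷ [])) path =
    copy v k ∷ ws , Equivalence.from (copy-on-time⇔ x-reachable k≡xv) v-fires TH.∷ subst (λ z → TH.Path z ws (encode y)) (encode-inc x v k k≡xv) pathH
    where
    k : Fin K
    k = next-copy x-reachable v
    k≡xv : toℕ k ≡ lookup x v
    k≡xv = toℕ-next-copy x-reachable v

  encode-reachable : ∀ {x} → Reachable x → TH.Reachable (encode x)
  encode-reachable {x} (_ , path) with ws , pathH ← simulate ([] , []) path =
    ws , subst (λ z → TH.Path z ws (encode x)) encode-zeros pathH

  encode-valid : ∀ {x} → Reachable x → TH.Valid (encode x)
  encode-valid = TH.reachable-valid ∘ encode-reachable

  unsimulate : ∀ {x ws z} → Reachable x → TH.Path (encode x) ws z → ∃[ y ] Reachable y × z ≡ encode y × ∃[ vs ] Path x vs y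
  unsimulate {x} x-reachable TH.[] = x , x-reachable , refl , [] , []
  unsimulate {x} {z = z} x-reachable (TH._∷_ {vs = ws} fires pathH)
    with v , k , refl , k≡xv , v-fires ← canFireH⇒ x-reachable fires
    with y , y-reachable , z≡y , vs , path ← unsimulate (reachable-path x-reachable (v-fires ∷ []))
                                                       (subst (λ a → TH.Path a ws z) (sym (encode-inc x v k k≡xv)) pathH)
    = y , y-reachable , z≡y , v ∷ vs , v-fires ∷ path

  reachableH⇒encode : ∀ {z} → TH.Reachable z → ∃[ x ] Reachable x × z ≡ encode x
  reachableH⇒encode {z} (ws , pathH)
    with x , x-reachable , z≡x , _ ← unsimulate ([] , []) (subst (λ a → TH.Path a ws z) (sym encode-zeros) pathH)
    = x , x-reachable , z≡x

  hcfg : Shot → Config m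
  hcfg x = TH.cfg (encode x)

  hcfg-zeros : hcfg zeros ≡ τ₀
  hcfg-zeros = trans (cong TH.cfg encode-zeros) TH.cfg-zeros

  stepH⇒stepG : ∀ {x τ′} → Reachable x → Step H (hcfg x) τ′ → ∃[ v ] CanFire x v × τ′ ≡ hcfg (inc x v)
  stepH⇒stepG {x} x-reachable (step p firable)
    with fires ← TH.firable⇒canFire {encode x} {p} (encode-valid x-reachable) firable
    with v , k , refl , k≡xv , v-fires ← canFireH⇒ x-reachable fires
    = v , v-fires , trans (TH.fire-cfg (encode-valid x-reachable) fires) (cong TH.cfg (sym (encode-inc x v k k≡xv)))

  H-convergent : Convergent H τ₀
  H-convergent = convergent ∘ infinite-simulation (Step G) (Step H) Shadows simulate-step
                                (zeros , ([] , []) , sym cfg-zeros , sym hcfg-zeros)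
    where
    Shadows : Config n → Config m → Set
    Shadows σ τ = ∃[ x ] Reachable x × σ ≡ cfg x × τ ≡ hcfg x
    simulate-step : ∀ {σ τ τ′} → Shadows σ τ → Step H τ τ′ → ∃[ σ′ ] Step G σ σ′ × Shadows σ′ τ′
    simulate-step (x , x-reachable , refl , refl) stepH with v , v-fires , τ′≡ ← stepH⇒stepG x-reachable stepH =
      cfg (inc x v) , fire-step (reachable-valid x-reachable) v-fires , inc x v , reachable-path x-reachable (v-fires ∷ []) , refl , τ′≡

  H-simple : Simple H τ₀
  H-simple vs exec
    with z , pathH ← TH.exec⇒path TH.zeros-valid (subst (λ τ → Exec H τ vs) (sym TH.cfg-zeros) exec)
    with x , _ , refl ← reachableH⇒encode (vs , pathH)
    = TH.path-unique (encode-≤1 x) pathH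

  encode-reflects-≤ : ∀ {x y} → Reachable x → encode x ≡ encode y → ∀ w → lookup x w ≤ lookup y w
  encode-reflects-≤ {x} {y} x-reachable x≡y w = ≮⇒≥ λ y<x → 1≢0 (begin
    1                                  ≡⟨ fired-< (subst (_< lookup x w) (sym (k≡yw y<x)) y<x) ⟨
    fired (toℕ (k y<x)) (lookup x w)   ≡⟨ lookup-encode-copy x w (k y<x) ⟨
    lookup (encode x) (copy w (k y<x)) ≡⟨ cong (λ z → lookup z (copy w (k y<x))) x≡y ⟩
    lookup (encode y) (copy w (k y<x)) ≡⟨ lookup-encode-copy y w (k y<x) ⟩
    fired (toℕ (k y<x)) (lookup y w)   ≡⟨ fired-≥ (≤-reflexive (sym (k≡yw y<x))) ⟩
    0                                  ∎)
    where
    open ≡-Reasoning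
    k : lookup y w < lookup x w → Fin K
    k y<x = fromℕ< (<-trans y<x (reachable-< x-reachable w))
    k≡yw : ∀ y<x → toℕ (k y<x) ≡ lookup y w
    k≡yw y<x = Finₚ.toℕ-fromℕ< _
    1≢0 : 1 ≢ 0
    1≢0 ()

  encode-injective : ∀ {x y} → Reachable x → Reachable y → encode x ≡ encode y → x ≡ y
  encode-injective {x} {y} x-reachable y-reachable x≡y =
    ≤ₛ-antisym {x} {y} (encode-reflects-≤ {x} {y} x-reachable x≡y) (encode-reflects-≤ {y} {x} y-reachable (sym x≡y))

  hcfg-injective : ∀ {x y} → Reachable x → Reachable y → hcfg x ≡ hcfg y → x ≡ y
  hcfg-injective x-reachable y-reachable x≈y =
    encode-injective x-reachable y-reachable
      (TH.Convergence.cfg-injective H-convergent (encode-reachable x-reachable) (encode-reachable y-reachable) x≈y)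

  reachG⇒reachH : ∀ {x y} → Reachable x → Reachable y → Reach G (cfg x) (cfg y) → Reach H (hcfg x) (hcfg y)
  reachG⇒reachH x-reachable y-reachable steps
    with vs , y′ , path , y′≈y ← reach⇒path (reachable-valid x-reachable) steps
    with refl ← cfg-injective (reachable-path x-reachable path) y-reachable y′≈y
    = TH.path⇒reach (encode-valid x-reachable) (proj₂ (simulate x-reachable path))

  reachH⇒reachG : ∀ {x y} → Reachable x → Reachable y → Reach H (hcfg x) (hcfg y) → Reach G (cfg x) (cfg y)
  reachH⇒reachG {x} x-reachable y-reachable steps
    with ws , z , pathH , z≈y ← TH.reach⇒path (encode-valid x-reachable) steps
    with y′ , y′-reachable , z≡y′ , vs , path ← unsimulate x-reachable pathH
    = subst (λ y → Reach G (cfg x) (cfg y)) (hcfg-injective y′-reachable y-reachable (trans (cong TH.cfg (sym z≡y′)) z≈y))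
            (path⇒reach (reachable-valid x-reachable) path)

  parametrisation : Parametrisation G σ₀ H τ₀
  parametrisation = record
    { State       = Shot
    ; Reachable   = Reachable
    ; cfgG        = cfg
    ; cfgH        = hcfg
    ; cfgG⁻¹      = unapply cfg
    ; cfgH⁻¹      = unapply hcfg
    ; cfgG⁻¹-cfgG = unapply-apply cfg cfg-injective
    ; cfgH⁻¹-cfgH = unapply-apply hcfg hcfg-injective
    ; reachG      = reachable⇒reach
    ; reachH      = TH.reachable⇒reach ∘ encode-reachable
    ; reachG⁻¹    = reach⇒reachable
    ; reachH⁻¹    = reachH⁻¹
    ; order       = λ x-reachable y-reachable →
                      mk⇔ (reachG⇒reachH x-reachable y-reachable) (reachH⇒reachG x-reachable y-reachable)
    }
    where
    reachH⁻¹ : ∀ {τ} → Reach H τ₀ τ → ∃[ x ] Reachable x × hcfg x ≡ τ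
    reachH⁻¹ steps with z , z-reachable , refl ← TH.reach⇒reachable steps
                   with x , x-reachable , refl ← reachableH⇒encode z-reachable = x , x-reachable , refl

mainTheorem1 : ∀ {n} (G : Graph n) (σ₀ : Config n) → Convergent G σ₀ →
    Σ ℕ λ m → Σ (Graph m) λ H → Σ (Config m) λ τ₀ →
      Convergent H τ₀ × Simple H τ₀ × Equivalent G σ₀ H τ₀
mainTheorem1 G σ₀ convergent =
  m , H , τ₀ , H-convergent , H-simple , parametrisation⇒equivalent parametrisation
  where open Splitting G σ₀ convergent
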